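{- Let $T$ be a tree with $\chi_{NL}(T)=k$. Then $\Delta(T)\le (k-1)^2+\frac{k-1}{2}$, where $\Delta(T)$ is the maximum degree of $T$.
   Context: A $k$-coloring of a graph $G$ is a partition of $V(G)$ into $k$ independent sets (colors). A coloring $\{S_1,\dots,S_k\}$ is neighbor-locating (an NL-coloring) if for any two distinct vertices $u,v$ in the same color class, $\{j: N(u)\cap S_j\neq\emptyset\}\neq\{j: N(v)\cap S_j\neq\emptyset\}$. The neighbor-locating chromatic number $\chi_{NL}(G)$ is the minimum number of colors in an NL-coloring of $G$. -}

module Defs where

open import Data.Nat using (ℕ; zero; suc; _+_; _⊔_; _<_)
open import Data.Bool using (Bool; true; false; if_then_else_)
open import Data.Fin using (Fin)
open import Data.List using (List; map; foldr; allFin)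
open import Data.Nat.ListAction using (sum)
open import Data.Vec using (Vec; lookup)
open import Data.Vec.Relation.Unary.Unique.Propositional using (Unique)
open import Data.Product using (Σ; ∃; _×_; _,_)
open import Data.Empty using (⊥)
open import Relation.Nullary using (¬_)
open import Relation.Binary.PropositionalEquality using (_≡_; _≢_)
open import Relation.Binary.Construct.Closure.ReflexiveTransitive using (Star)
open import Function.Bundles using (_⇔_)
open import Function.Definitions using (Surjective)

record Graph (n : ℕ) : Set where
  field
    adj     : Fin n → Fin n → Bool
    symm    : ∀ u v → adj u v ≡ adj v u
    irrefl  : ∀ v → adj v v ≡ false

open Graph public

Adj : ∀ {n} → Graph n → Fin n → Fin n → Set
Adj G u v = adj G u v ≡ true

Connected : ∀ {n} → Graph n → Set
Connected G = ∀ u v → Star (Adj G) u v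

record Cycle {n} (G : Graph n) : Set where
  field
    len    : ℕ
    verts  : Vec (Fin n) (suc (suc (suc len)))
    distinct : Unique verts
    consec : ∀ (i : Fin (suc (suc len))) →
               Adj G (lookup verts (Data.Fin.inject₁ i)) (lookup verts (Data.Fin.suc i))
    closing : Adj G (lookup verts (Data.Fin.fromℕ (suc (suc len)))) (lookup verts Data.Fin.zero)

Acyclic : ∀ {n} → Graph n → Set
Acyclic G = ¬ Cycle G

IsTree : ∀ {n} → Graph n → Set
IsTree {n} G = (0 < n) × Connected G × Acyclic G

degree : ∀ {n} → Graph n → Fin n → ℕ
degree {n} G v = sum (map (λ u → if adj G v u then 1 else 0) (allFin n))

maxDegree : ∀ {n} → Graph n → ℕ
maxDegree {n} G = foldr _⊔_ 0 (map (degree G) (allFin n))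

-- A k-coloring: a partition of V(G) into k (nonempty) independent sets,
-- given by a surjective colour map c : Fin n → Fin k with no monochromatic edge.
record Coloring {n} (G : Graph n) (k : ℕ) : Set where
  field
    col    : Fin n → Fin k
    onto   : Surjective _≡_ _≡_ col
    proper : ∀ u v → Adj G u v → col u ≢ col v

open Coloring public

NbrHasColor : ∀ {n k} {G : Graph n} → Coloring G k → Fin n → Fin k → Set
NbrHasColor {G = G} c u j = ∃ λ w → Adj G u w × col c w ≡ j

IsNeighborLocating : ∀ {n k} {G : Graph n} → Coloring G k → Set
IsNeighborLocating {n} {k} c =
  ∀ (u v : Fin n) → u ≢ v → col c u ≡ col c v →
    ¬ (∀ (j : Fin k) → NbrHasColor c u j ⇔ NbrHasColor c v j)

HasNLColoring : ∀ {n} → Graph n → ℕ → Set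
HasNLColoring G k = Σ (Coloring G k) IsNeighborLocating

χNL≡ : ∀ {n} → Graph n → ℕ → Set
χNL≡ G k = HasNLColoring G k × (∀ k′ → k′ < k → ¬ HasNLColoring G k′)

module Submission where

-- Maximum degree of a tree with neighbour-locating chromatic number k:
-- 2Δ ≤ 2(k-1)² + (k-1).
--
-- Fix an NL-colouring of an acyclic graph with k = m + 1 colours and a vertex v
-- of colour c.  We label TWO copies of the neighbourhood of v injectively by
--   * leaf signatures (colour of a leaf, colour of its only neighbour), which
--     are pairs of distinct colours: (m+1)·m of them, and
--   * pairs (j, a) with j ≠ c and a ≠ j: m·m of them,
-- so 2·deg v ≤ 2m² + m.  Beyond every edge v → u lies a leaf (walk on without
-- backtracking until stuck), and leaves beyond different neighbours differ
-- (otherwise the forest has a cycle).  The NL property distinguishes leaves by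
-- their signature, so a leaf signature identifies the neighbour.  The first
-- copy of u gets the signature of a leaf beyond u.  If u has two neighbours
-- w₁, w₂ of distinct colours other than c, both copies use leaves beyond u
-- through w₁ resp. w₂, which differ; otherwise u sees exactly the colours
-- {c, a}, and the second copy gets (colour of u, a), which identifies u by the
-- NL property.

open import Defs
open import Data.Nat using (ℕ; zero; suc; _+_; _*_; _∸_; _≤_; _⊔_; z≤n; s≤s)
open import Data.Nat.Properties
  using (≤-trans; ≤-reflexive; +-suc; +-identityʳ; n≤1+n; 1+n≰n; *-distribˡ-⊔; ⊔-lub; module ≤-Reasoning)
open import Data.Nat.ListAction using (sum)
open import Data.Nat.ListAction.Properties using (sum-++)
open import Data.Nat.Tactic.RingSolver using (solve-∀)
open import Data.Bool using (Bool; true; false; if_then_else_)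
import Data.Bool.Properties as Bool
import Data.Fin as Fin
open import Data.Fin using (Fin; punchIn; punchOut; inject₁; fromℕ)
open import Data.Fin.Properties using (_≟_; any?; punchIn-punchOut)
open import Data.List
  using (List; []; _∷_; _++_; _ʳ++_; length; map; allFin; cartesianProductWith)
open import Data.List.Properties using (length-++; length-map; length-tabulate; map-++; map-∘; foldr-preservesᵇ)
open import Data.List.Membership.Propositional using (_∈_; _∉_)
open import Data.List.Membership.Propositional.Properties
  using (∈-∃++; ∈-++⁻; ∈-++⁺ˡ; ∈-++⁺ʳ; ∈-insert; ∈-map⁺; ∈-map⁻; ∈-allFin; ∈-cartesianProductWith⁺)
open import Data.List.Relation.Binary.Subset.Propositional using (_⊆_)
open import Data.List.Relation.Unary.Any using (here; there)
open import Data.List.Relation.Unary.All as All using ([]; _∷_)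
open import Data.List.Relation.Unary.All.Properties using (¬Any⇒All¬; ++⁻ˡ; tabulate⁺) renaming (map⁺ to All-map⁺)
open import Data.List.Relation.Unary.AllPairs using ([]; _∷_)
open import Data.List.Relation.Unary.Linked using (Linked; [-]; _∷_)
open import Data.List.Relation.Unary.Unique.Propositional using (Unique)
import Data.List.Relation.Unary.Unique.Propositional.Properties as Unique
open import Data.Vec using (lookup; fromList)
import Data.Vec.Relation.Unary.AllPairs as VecAllPairs
import Data.Vec.Relation.Unary.All.Properties as VecAll
import Data.Vec.Relation.Unary.Unique.Propositional as Vec
open import Data.Product using (Σ; ∃; _×_; _,_; proj₁; proj₂)
open import Data.Sum using (_⊎_; inj₁; inj₂; [_,_]′)
open import Data.Sum.Properties using (inj₁-injective; inj₂-injective)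
open import Data.Empty using (⊥-elim)
open import Function.Bundles using (_⇔_; mk⇔)
open import Function.Construct.Composition using (_⇔-∘_)
open import Function.Construct.Symmetry using (⇔-sym)
open import Relation.Nullary using (¬_; Dec; yes; no; ¬?)
open import Relation.Nullary.Decidable using (_×-dec_)
open import Relation.Binary.PropositionalEquality
  using (_≡_; _≢_; refl; sym; trans; cong; cong₂; subst; subst₂; module ≡-Reasoning)

module _ {A : Set} where

  unique-⊆-length : ∀ {xs ys : List A} → Unique xs → xs ⊆ ys → length xs ≤ length ys
  unique-⊆-length {[]}     _            _   = z≤n
  unique-⊆-length {x ∷ xs} (x∉xs ∷ xs!) xs⊆ys with ∈-∃++ (xs⊆ys (here refl))
  ... | ys₁ , ys₂ , refl = begin
    suc (length xs)               ≤⟨ s≤s (unique-⊆-length xs! xs⊆ys₁ys₂) ⟩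
    suc (length (ys₁ ++ ys₂))     ≡⟨ cong suc (length-++ ys₁) ⟩
    suc (length ys₁ + length ys₂) ≡⟨ +-suc (length ys₁) (length ys₂) ⟨
    length ys₁ + length (x ∷ ys₂) ≡⟨ length-++ ys₁ ⟨
    length (ys₁ ++ x ∷ ys₂)       ∎
    where
    open ≤-Reasoning
    xs⊆ys₁ys₂ : xs ⊆ ys₁ ++ ys₂
    xs⊆ys₁ys₂ z∈xs with ∈-++⁻ ys₁ (xs⊆ys (there z∈xs))
    ... | inj₁ z∈ys₁         = ∈-++⁺ˡ z∈ys₁
    ... | inj₂ (here refl)   = ⊥-elim (All.lookup x∉xs z∈xs refl)
    ... | inj₂ (there z∈ys₂) = ∈-++⁺ʳ ys₁ z∈ys₂

  unique-rotate : ∀ (xs : List A) {y ys} → Unique (xs ++ y ∷ ys) → Unique (y ∷ xs)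
  unique-rotate []       _              = [] ∷ []
  unique-rotate (x ∷ xs) (x∉rest ∷ rest!) with unique-rotate xs rest!
  ... | y∉xs ∷ xs! =
    ((λ y≡x → All.lookup x∉rest (∈-insert xs) (sym y≡x)) ∷ y∉xs)
    ∷ ++⁻ˡ xs x∉rest ∷ xs!

  ʳ++-unique-suffix : ∀ (xs : List A) {ys} → Unique (xs ʳ++ ys) → Unique ys
  ʳ++-unique-suffix []       ys! = ys!
  ʳ++-unique-suffix (x ∷ xs) u with ʳ++-unique-suffix xs u
  ... | _ ∷ ys! = ys!

  ʳ++-unique-disjoint : ∀ (xs : List A) {ys x z} → Unique (xs ʳ++ ys) → x ∈ xs → z ∈ ys → x ≢ z
  ʳ++-unique-disjoint (x ∷ xs) u (here refl) z∈ys with ʳ++-unique-suffix xs u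
  ... | x∉ys ∷ _ = All.lookup x∉ys z∈ys
  ʳ++-unique-disjoint (_ ∷ xs) u (there x∈xs) z∈ys = ʳ++-unique-disjoint xs u x∈xs (there z∈ys)

  count : (A → Bool) → List A → ℕ
  count g xs = sum (map (λ x → if g x then 1 else 0) xs)

  count-++ : ∀ g xs ys → count g (xs ++ ys) ≡ count g xs + count g ys
  count-++ g xs ys = trans (cong sum (map-++ _ xs ys)) (sum-++ (map _ xs) _)

length-allFin : ∀ r → length (allFin r) ≡ r
length-allFin r = length-tabulate (λ i → i)

module _ {A B : Set} where

  count-map : ∀ (g : B → Bool) (f : A → B) xs → count g (map f xs) ≡ count (λ x → g (f x)) xs
  count-map g f xs = cong sum (sym (map-∘ xs))

  length-cartesianProductWith : ∀ {C : Set} (f : A → B → C) xs ys →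
    length (cartesianProductWith f xs ys) ≡ length xs * length ys
  length-cartesianProductWith f []       ys = refl
  length-cartesianProductWith f (x ∷ xs) ys = begin
    length (map (f x) ys ++ cartesianProductWith f xs ys)          ≡⟨ length-++ (map (f x) ys) ⟩
    length (map (f x) ys) + length (cartesianProductWith f xs ys)  ≡⟨ cong₂ _+_ (length-map (f x) ys)
                                                                        (length-cartesianProductWith f xs ys) ⟩
    length ys + length xs * length ys                              ∎
    where open ≡-Reasoning

module CountByInjection {A B : Set} (g : A → Bool) (F : ∀ x → g x ≡ true → B)
  (F-injective : ∀ {x y} gx gy → F x gx ≡ F y gy → x ≡ y) where

  consImage : ∀ x b → g x ≡ b → List B → List B
  consImage x true  gx ys = F x gx ∷ ys
  consImage x false _  ys = ys

  image : List A → List B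
  image []       = []
  image (x ∷ xs) = consImage x (g x) refl (image xs)

  length-image : ∀ xs → count g xs ≡ length (image xs)
  length-image []       = refl
  length-image (x ∷ xs) = go (g x) refl
    where
    go : ∀ b (gx : g x ≡ b) → (if b then 1 else 0) + count g xs ≡ length (consImage x b gx (image xs))
    go true  _ = cong suc (length-image xs)
    go false _ = length-image xs

  ∈-image⁻ : ∀ xs {y} → y ∈ image xs → ∃ λ x → x ∈ xs × Σ (g x ≡ true) λ gx → y ≡ F x gx
  ∈-image⁻ (x ∷ xs) {y} = go (g x) refl
    where
    go : ∀ b (gx : g x ≡ b) → y ∈ consImage x b gx (image xs) →
         ∃ λ z → z ∈ x ∷ xs × Σ (g z ≡ true) λ gz → y ≡ F z gz
    go true  gx (here refl) = x , here refl , gx , refl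
    go true  gx (there y∈) with ∈-image⁻ xs y∈
    ... | z , z∈ , gz , refl = z , there z∈ , gz , refl
    go false gx y∈ with ∈-image⁻ xs y∈
    ... | z , z∈ , gz , refl = z , there z∈ , gz , refl

  image-unique : ∀ xs → Unique xs → Unique (image xs)
  image-unique []       []            = []
  image-unique (x ∷ xs) (x∉xs ∷ xs!) = go (g x) refl
    where
    go : ∀ b (gx : g x ≡ b) → Unique (consImage x b gx (image xs))
    go true  gx = All.tabulate fresh ∷ image-unique xs xs!
      where
      fresh : ∀ {y} → y ∈ image xs → F x gx ≢ y
      fresh y∈ Fx≡y with ∈-image⁻ xs y∈
      ... | z , z∈xs , gz , refl = All.lookup x∉xs z∈xs (F-injective gx gz Fx≡y)
    go false _ = image-unique xs xs!

  count-≤ : ∀ xs (T : List B) → Unique xs → (∀ x gx → F x gx ∈ T) → count g xs ≤ length T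
  count-≤ xs T xs! F∈T = subst (_≤ length T) (sym (length-image xs))
    (unique-⊆-length (image-unique xs xs!) image⊆T)
    where
    image⊆T : image xs ⊆ T
    image⊆T y∈ with ∈-image⁻ xs y∈
    ... | x , _ , gx , refl = F∈T x gx

module _ {n} (G : Graph n) where

  adj-sym : ∀ {x y} → Adj G x y → Adj G y x
  adj-sym {x} {y} x~y = trans (symm G y x) x~y

  adj-irrefl : ∀ {x} → ¬ Adj G x x
  adj-irrefl {x} x~x with trans (sym x~x) (irrefl G x)
  ... | ()

  adj? : ∀ x y → Dec (Adj G x y)
  adj? x y = adj G x y Bool.≟ true

  Walk : List (Fin n) → Set
  Walk = Linked (Adj G)

  record Pendant (ℓ p : Fin n) : Set where
    field
      adjacent : Adj G ℓ p
      only     : ∀ y → Adj G ℓ y → y ≡ p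

module _ {A : Set} {R : A → A → Set} where

  linked-prefix : ∀ xs {y ys} → Linked R (xs ++ y ∷ ys) → Linked R (xs ++ y ∷ [])
  linked-prefix []           _       = [-]
  linked-prefix (x ∷ [])     (r ∷ _) = r ∷ [-]
  linked-prefix (x ∷ x′ ∷ xs) (r ∷ w) = r ∷ linked-prefix (x′ ∷ xs) w

module _ {n} {G : Graph n} where

  walk-step : ∀ a l b → Walk G (a ∷ l ++ b ∷ []) → ∀ (i : Fin (length l)) →
    Adj G (lookup (fromList (a ∷ l)) (inject₁ i)) (lookup (fromList (a ∷ l)) (Fin.suc i))
  walk-step a (y ∷ l) b (a~y ∷ w) Fin.zero    = a~y
  walk-step a (y ∷ l) b (_   ∷ w) (Fin.suc i) = walk-step y l b w i

  walk-last-step : ∀ a l b → Walk G (a ∷ l ++ b ∷ []) →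
    Adj G (lookup (fromList (a ∷ l)) (fromℕ (length l))) b
  walk-last-step a []      b (a~b ∷ _) = a~b
  walk-last-step a (y ∷ l) b (_   ∷ w) = walk-last-step y l b w

  unique-fromList : ∀ {xs : List (Fin n)} → Unique xs → Vec.Unique (fromList xs)
  unique-fromList []           = VecAllPairs.[]
  unique-fromList (x∉xs ∷ xs!) = VecAll.fromList⁺ x∉xs VecAllPairs.∷ unique-fromList xs!

  closed-walk⇒cycle : ∀ x y z cs → Unique (x ∷ y ∷ z ∷ cs) → Walk G (x ∷ y ∷ z ∷ cs ++ x ∷ []) → Cycle G
  closed-walk⇒cycle x y z cs distinct w = record
    { len      = length cs
    ; verts    = fromList (x ∷ y ∷ z ∷ cs)
    ; distinct = unique-fromList distinct
    ; consec   = walk-step x (y ∷ z ∷ cs) x w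
    ; closing  = walk-last-step x (y ∷ z ∷ cs) x w
    }

module Forest {n} (G : Graph n) (acyclic : Acyclic G) where

  V : Set
  V = Fin n

  data NBWalk : List V → Set where
    edge : ∀ {x y} → Adj G x y → NBWalk (x ∷ y ∷ [])
    step : ∀ {x y z r} → Adj G x y → x ≢ z → NBWalk (y ∷ z ∷ r) → NBWalk (x ∷ y ∷ z ∷ r)

  nbWalk-head : ∀ {x y r} → NBWalk (x ∷ y ∷ r) → Adj G x y
  nbWalk-head (edge x~y)     = x~y
  nbWalk-head (step x~y _ _) = x~y

  nbWalk⇒walk : ∀ {xs} → NBWalk xs → Walk G xs
  nbWalk⇒walk (edge x~y)     = x~y ∷ [-]
  nbWalk⇒walk (step x~y _ w) = x~y ∷ nbWalk⇒walk w

  -- If the rest of a non-backtracking walk has no repetition, its first vertex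
  -- does not reappear: a return after one step is a loop, after two steps a
  -- backtrack, and after more steps a cycle.
  nbWalk-head-fresh : ∀ {x rest} → NBWalk (x ∷ rest) → Unique rest → x ∉ rest
  nbWalk-head-fresh {x} w rest! x∈rest with ∈-∃++ x∈rest
  ... | []          , _ , refl = adj-irrefl G (nbWalk-head w)
  ... | _ ∷ []      , _ , refl with w
  ...   | step _ x≢x _ = x≢x refl
  nbWalk-head-fresh {x} w rest! _ | y ∷ z ∷ cs , _ , refl =
    acyclic (closed-walk⇒cycle x y z cs (unique-rotate (y ∷ z ∷ cs) rest!)
                               (linked-prefix (x ∷ y ∷ z ∷ cs) (nbWalk⇒walk w)))

  nbWalk-unique : ∀ {xs} → NBWalk xs → Unique xs
  nbWalk-unique w@(edge x~y)   = ¬Any⇒All¬ _ (nbWalk-head-fresh w ([] ∷ [])) ∷ [] ∷ []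
  nbWalk-unique w@(step _ _ w′) = ¬Any⇒All¬ _ (nbWalk-head-fresh w rest!) ∷ rest!
    where rest! = nbWalk-unique w′

  nbWalk-reverse-onto : ∀ {a b} ys {zs} → NBWalk (b ∷ a ∷ ys) → NBWalk (a ∷ b ∷ zs) →
                        NBWalk (ys ʳ++ a ∷ b ∷ zs)
  nbWalk-reverse-onto []      _                 w = w
  nbWalk-reverse-onto (y ∷ ys) (step _ b≢y w′) w =
    nbWalk-reverse-onto ys w′ (step (adj-sym G (nbWalk-head w′)) (λ y≡b → b≢y (sym y≡b)) w)

  record LeafBeyond (s u : V) : Set where
    field
      rest    : List V
      walk    : NBWalk (s ∷ u ∷ rest)
      leaf    : V
      parent  : V
      leaf∈   : leaf ∈ u ∷ rest
      pendant : Pendant G leaf parent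

  open LeafBeyond public

  -- Leaves beyond different neighbours of s are different: otherwise the two
  -- walks glue to a non-backtracking walk visiting that leaf twice.
  leaves-beyond-distinct : ∀ {s u₁ u₂} (L₁ : LeafBeyond s u₁) (L₂ : LeafBeyond s u₂) →
                           u₁ ≢ u₂ → leaf L₁ ≢ leaf L₂
  leaves-beyond-distinct {s} {u₁} {u₂} L₁ L₂ u₁≢u₂ =
    ʳ++-unique-disjoint (u₁ ∷ rest L₁) (nbWalk-unique glued) (leaf∈ L₁) (there (leaf∈ L₂))
    where
    glued : NBWalk ((u₁ ∷ rest L₁) ʳ++ s ∷ u₂ ∷ rest L₂)
    glued = nbWalk-reverse-onto (u₁ ∷ rest L₁)
              (step (adj-sym G (nbWalk-head (walk L₂))) (λ u₂≡u₁ → u₁≢u₂ (sym u₂≡u₁)) (walk L₁))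
              (walk L₂)

  extend : ∀ {s u w} → LeafBeyond u w → Adj G s u → s ≢ w → LeafBeyond s u
  extend L s~u s≢w = record
    { rest = _ ∷ rest L ; walk = step s~u s≢w (walk L) ; leaf = leaf L ; parent = parent L
    ; leaf∈ = there (leaf∈ L) ; pendant = pendant L }

  path-length : ∀ {xs} → NBWalk xs → length xs ≤ n
  path-length {xs} w = ≤-trans (unique-⊆-length (nbWalk-unique w) (λ {x} _ → ∈-allFin x))
                               (≤-reflexive (length-allFin n))

  -- Walk on from u without backtracking until stuck; the vertex where we get
  -- stuck is a leaf.  trail is the walk so far (reversed, before u and s); since
  -- walks are paths, n steps of fuel suffice.
  walk-to-leaf : ∀ fuel s u trail → NBWalk (u ∷ s ∷ trail) → n ≤ fuel + length trail → LeafBeyond s u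
  walk-to-leaf zero s u trail w n≤trail =
    ⊥-elim (1+n≰n (≤-trans (n≤1+n _) (≤-trans (path-length w) n≤trail)))
  walk-to-leaf (suc fuel) s u trail w n≤ with any? (λ x → adj? G u x ×-dec ¬? (x ≟ s))
  ... | yes (x , u~x , x≢s) =
    extend (walk-to-leaf fuel u x (s ∷ trail) (step (adj-sym G u~x) x≢s w)
                         (subst (n ≤_) (sym (+-suc fuel (length trail))) n≤))
           (adj-sym G (nbWalk-head w)) (λ s≡x → x≢s (sym s≡x))
  ... | no stuck = record
    { rest = [] ; walk = edge (adj-sym G (nbWalk-head w)) ; leaf = u ; parent = s
    ; leaf∈ = here refl ; pendant = record { adjacent = nbWalk-head w ; only = only-s } }
    where
    only-s : ∀ y → Adj G u y → y ≡ s
    only-s y u~y with y ≟ s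
    ... | yes y≡s = y≡s
    ... | no  y≢s = ⊥-elim (stuck (y , u~y , y≢s))

  leafBeyond : ∀ {s u} → Adj G s u → LeafBeyond s u
  leafBeyond {s} {u} s~u =
    walk-to-leaf n s u [] (edge (adj-sym G s~u)) (≤-reflexive (sym (+-identityʳ n)))

module Locating {n k} {G : Graph n} (C : Coloring G k) (nl : IsNeighborLocating C) where

  locate : ∀ {u u′} → col C u ≡ col C u′ →
           (∀ j → NbrHasColor C u j ⇔ NbrHasColor C u′ j) → u ≡ u′
  locate {u} {u′} same-colour same-around with u ≟ u′
  ... | yes u≡u′ = u≡u′
  ... | no  u≢u′ = ⊥-elim (nl u u′ u≢u′ same-colour same-around)

  pendant-colours : ∀ {ℓ p} → Pendant G ℓ p → ∀ j → NbrHasColor C ℓ j ⇔ (col C p ≡ j)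
  pendant-colours {ℓ} {p} P j = mk⇔ (λ { (y , ℓ~y , y-j) → trans (cong (col C) (sym (Pendant.only P y ℓ~y))) y-j })
                                    (λ p-j → p , Pendant.adjacent P , p-j)

  pendant-locate : ∀ {ℓ p ℓ′ p′} → Pendant G ℓ p → Pendant G ℓ′ p′ →
                   col C ℓ ≡ col C ℓ′ → col C p ≡ col C p′ → ℓ ≡ ℓ′
  pendant-locate P P′ same-colour same-parent = locate same-colour λ j →
    ⇔-sym (pendant-colours P′ j) ⇔-∘ (mk⇔ (trans (sym same-parent)) (trans same-parent) ⇔-∘ pendant-colours P j)

-- The identity behind the count of labels: (m + 1)·m + m·m = 2m² + m.
label-count : ∀ m → suc m * m + m * m ≡ 2 * (m * m) + m
label-count = solve-∀

module DegreeBound {n} (G : Graph n) (acyclic : Acyclic G) {m} (C : Coloring G (suc m))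
                   (nl : IsNeighborLocating C) (v : Fin n) where
  open Forest G acyclic
  open Locating C nl

  K : Set
  K = Fin (suc m)

  cl : V → K
  cl = col C

  c : K
  c = cl v

  colour-≢ : ∀ {x y} → cl x ≢ cl y → x ≢ y
  colour-≢ cx≢cy x≡y = cx≢cy (cong cl x≡y)

  Within : V → K → Set
  Within u a = ∀ j → NbrHasColor C u j → j ≡ c ⊎ j ≡ a

  data Kind (u : V) : Set where
    poor : (a : K) → Within u a → a ≡ c ⊎ NbrHasColor C u a → Kind u
    rich : (w₁ w₂ : V) → Adj G u w₁ → Adj G u w₂ → cl w₁ ≢ c → cl w₂ ≢ c → cl w₂ ≢ cl w₁ → Kind u

  within : ∀ {u} a → (∀ w → ¬ (Adj G u w × cl w ≢ c × cl w ≢ a)) → Within u a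
  within a none j (w , u~w , w-j) with cl w ≟ c | cl w ≟ a
  ... | yes w-c | _       = inj₁ (trans (sym w-j) w-c)
  ... | no _    | yes w-a = inj₂ (trans (sym w-j) w-a)
  ... | no w≢c  | no w≢a  = ⊥-elim (none w (u~w , w≢c , w≢a))

  kind : ∀ u → Kind u
  kind u with any? (λ w → adj? G u w ×-dec ¬? (cl w ≟ c))
  ... | no none = poor c (within c λ w (u~w , w≢c , _) → none (w , u~w , w≢c)) (inj₁ refl)
  ... | yes (w₁ , u~w₁ , w₁≢c)
    with any? (λ w → adj? G u w ×-dec (¬? (cl w ≟ c) ×-dec ¬? (cl w ≟ cl w₁)))
  ...   | yes (w₂ , u~w₂ , w₂≢c , w₂≢w₁) = rich w₁ w₂ u~w₁ u~w₂ w₁≢c w₂≢c w₂≢w₁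
  ...   | no none = poor (cl w₁) (within (cl w₁) λ w seen → none (w , seen)) (inj₂ (w₁ , u~w₁ , refl))

  poor-colours : ∀ {u a} → Adj G v u → Within u a → a ≡ c ⊎ NbrHasColor C u a →
                 ∀ j → NbrHasColor C u j ⇔ (j ≡ c ⊎ j ≡ a)
  poor-colours {u} {a} v~u within-a a-seen j = mk⇔ (within-a j) (seen a-seen)
    where
    seen : ∀ {j} → a ≡ c ⊎ NbrHasColor C u a → j ≡ c ⊎ j ≡ a → NbrHasColor C u j
    seen _            (inj₁ j≡c)  = v , adj-sym G v~u , sym j≡c
    seen (inj₁ a≡c)   (inj₂ refl) = v , adj-sym G v~u , sym a≡c
    seen (inj₂ a-seen) (inj₂ refl) = a-seen

  signature : ∀ {s u} → LeafBeyond s u → K × K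
  signature L = cl (leaf L) , cl (parent L)

  same-leaf : ∀ {s u s′ u′} (L : LeafBeyond s u) (L′ : LeafBeyond s′ u′) →
              signature L ≡ signature L′ → leaf L ≡ leaf L′
  same-leaf L L′ same = pendant-locate (pendant L) (pendant L′) (cong proj₁ same) (cong proj₂ same)

  signature-injective : ∀ {u u′} (L : LeafBeyond v u) (L′ : LeafBeyond v u′) →
                        signature L ≡ signature L′ → u ≡ u′
  signature-injective {u} {u′} L L′ same with u ≟ u′
  ... | yes u≡u′ = u≡u′
  ... | no  u≢u′ = ⊥-elim (leaves-beyond-distinct L L′ u≢u′ (same-leaf L L′ same))

  -- A leaf beyond v → u reached through a neighbour w of u whose colour is not c
  -- (so w ≠ v).
  leafThrough : ∀ {u w} → Adj G v u → Adj G u w → cl w ≢ c → LeafBeyond v u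
  leafThrough v~u u~w w≢c = extend (leafBeyond u~w) v~u (colour-≢ (λ c≡w → w≢c (sym c≡w)))

  firstLeaf : ∀ {u} → Adj G v u → Kind u → LeafBeyond v u
  firstLeaf v~u (poor _ _ _)                 = leafBeyond v~u
  firstLeaf v~u (rich _ _ u~w₁ _ w₁≢c _ _)   = leafThrough v~u u~w₁ w₁≢c

  -- Labels: leaf signatures, and (colour of u, a) for poor neighbours u.
  Label : Set
  Label = (K × K) ⊎ (K × K)

  label₁ : ∀ {u} → Adj G v u → Kind u → Label
  label₁ v~u k = inj₁ (signature (firstLeaf v~u k))

  label₂ : ∀ {u} → Adj G v u → Kind u → Label
  label₂ {u} v~u (poor a _ _)                = inj₂ (cl u , a)
  label₂ v~u (rich _ _ _ u~w₂ _ w₂≢c _)     = inj₁ (signature (leafThrough v~u u~w₂ w₂≢c))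

  label₁-injective : ∀ {u u′} (v~u : Adj G v u) (v~u′ : Adj G v u′) k k′ →
                     label₁ v~u k ≡ label₁ v~u′ k′ → u ≡ u′
  label₁-injective v~u v~u′ k k′ same =
    signature-injective (firstLeaf v~u k) (firstLeaf v~u′ k′) (inj₁-injective same)

  label₂-injective : ∀ {u u′} (v~u : Adj G v u) (v~u′ : Adj G v u′) k k′ →
                     label₂ v~u k ≡ label₂ v~u′ k′ → u ≡ u′
  label₂-injective v~u v~u′ (poor a within-a a-seen) (poor a′ within-a′ a′-seen) same
    with cong proj₂ (inj₂-injective same)
  ... | refl = locate (cong proj₁ (inj₂-injective same)) λ j →
                 ⇔-sym (poor-colours v~u′ within-a′ a′-seen j) ⇔-∘ poor-colours v~u within-a a-seen j
  label₂-injective v~u v~u′ (poor _ _ _) (rich _ _ _ _ _ _ _) ()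
  label₂-injective v~u v~u′ (rich _ _ _ _ _ _ _) (poor _ _ _) ()
  label₂-injective v~u v~u′ (rich _ _ _ u~w₂ _ w₂≢c _) (rich _ _ _ u′~w₂′ _ w₂′≢c _) same =
    signature-injective (leafThrough v~u u~w₂ w₂≢c) (leafThrough v~u′ u′~w₂′ w₂′≢c) (inj₁-injective same)

  -- A label shared by a first and a second copy comes from a single vertex ...
  label₁≡label₂ : ∀ {u u′} (v~u : Adj G v u) (v~u′ : Adj G v u′) k k′ →
                  label₁ v~u k ≡ label₂ v~u′ k′ → u ≡ u′
  label₁≡label₂ v~u v~u′ k (poor _ _ _) ()
  label₁≡label₂ v~u v~u′ k (rich _ _ _ u′~w₂ _ w₂≢c _) same =
    signature-injective (firstLeaf v~u k) (leafThrough v~u′ u′~w₂ w₂≢c) (inj₁-injective same)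

  -- ... but the two labels of one vertex differ: for rich u the two leaves lie
  -- in different branches at u.
  label₁≢label₂ : ∀ {u} (v~u v~u′ : Adj G v u) k → label₁ v~u k ≢ label₂ v~u′ k
  label₁≢label₂ v~u v~u′ (poor _ _ _) ()
  label₁≢label₂ v~u v~u′ (rich w₁ w₂ u~w₁ u~w₂ w₁≢c w₂≢c w₂≢w₁) same =
    leaves-beyond-distinct (leafBeyond u~w₁) (leafBeyond u~w₂) (colour-≢ (λ w₁≡w₂ → w₂≢w₁ (sym w₁≡w₂)))
      (same-leaf (leafThrough v~u u~w₁ w₁≢c) (leafThrough v~u′ u~w₂ w₂≢c) (inj₁-injective same))

  -- Two copies of the vertex set; the elements to be counted are the neighbours of v.
  isNeighbour : V ⊎ V → Bool
  isNeighbour = [ adj G v , adj G v ]′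

  label : ∀ x → isNeighbour x ≡ true → Label
  label (inj₁ u) v~u = label₁ v~u (kind u)
  label (inj₂ u) v~u = label₂ v~u (kind u)

  first≢second : ∀ {u u′} (v~u : Adj G v u) (v~u′ : Adj G v u′) →
                 label₁ v~u (kind u) ≢ label₂ v~u′ (kind u′)
  first≢second v~u v~u′ same with label₁≡label₂ v~u v~u′ (kind _) (kind _) same
  ... | refl = label₁≢label₂ v~u v~u′ (kind _) same

  label-injective : ∀ {x y} gx gy → label x gx ≡ label y gy → x ≡ y
  label-injective {inj₁ u} {inj₁ u′} v~u v~u′ same = cong inj₁ (label₁-injective v~u v~u′ (kind u) (kind u′) same)
  label-injective {inj₁ _} {inj₂ _} v~u v~u′ same = ⊥-elim (first≢second v~u v~u′ same)
  label-injective {inj₂ _} {inj₁ _} v~u v~u′ same = ⊥-elim (first≢second v~u′ v~u (sym same))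
  label-injective {inj₂ u} {inj₂ u′} v~u v~u′ same = cong inj₂ (label₂-injective v~u v~u′ (kind u) (kind u′) same)

  offDiagonal : List K → List (K × K)
  offDiagonal js = cartesianProductWith (λ j b → j , punchIn j b) js (allFin m)

  ∈-offDiagonal : ∀ {j a js} → j ∈ js → a ≢ j → (j , a) ∈ offDiagonal js
  ∈-offDiagonal {j} {a} {js} j∈js a≢j =
    subst (λ b → (j , b) ∈ offDiagonal js) (punchIn-punchOut j≢a)
          (∈-cartesianProductWith⁺ (λ j b → j , punchIn j b) j∈js (∈-allFin (punchOut j≢a)))
    where
    j≢a : j ≢ a
    j≢a j≡a = a≢j (sym j≡a)

  length-offDiagonal : ∀ js → length (offDiagonal js) ≡ length js * m
  length-offDiagonal js = trans (length-cartesianProductWith _ js (allFin m)) (cong (length js *_) (length-allFin m))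

  otherColours : List K
  otherColours = map (punchIn c) (allFin m)

  ∈-otherColours : ∀ {j} → j ≢ c → j ∈ otherColours
  ∈-otherColours j≢c = subst (_∈ otherColours) (punchIn-punchOut (λ c≡j → j≢c (sym c≡j)))
                             (∈-map⁺ (punchIn c) (∈-allFin _))

  -- All possible labels: signatures are pairs of distinct colours (a leaf and
  -- its neighbour), and a poor u has colour ≠ c and sees a ≠ colour of u.
  labels : List Label
  labels = map inj₁ (offDiagonal (allFin (suc m))) ++ map inj₂ (offDiagonal otherColours)

  length-labels : length labels ≡ 2 * (m * m) + m
  length-labels = begin
    length labels
      ≡⟨ length-++ (map inj₁ (offDiagonal (allFin (suc m)))) ⟩
    length (map inj₁ (offDiagonal (allFin (suc m)))) + length (map inj₂ (offDiagonal otherColours))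
      ≡⟨ cong₂ _+_ (length-map inj₁ (offDiagonal (allFin (suc m)))) (length-map inj₂ (offDiagonal otherColours)) ⟩
    length (offDiagonal (allFin (suc m))) + length (offDiagonal otherColours)
      ≡⟨ cong₂ _+_ (length-offDiagonal (allFin (suc m))) (length-offDiagonal otherColours) ⟩
    length (allFin (suc m)) * m + length otherColours * m
      ≡⟨ cong₂ (λ a b → a * m + b * m) (length-allFin (suc m)) (trans (length-map (punchIn c) (allFin m)) (length-allFin m)) ⟩
    suc m * m + m * m
      ≡⟨ label-count m ⟩
    2 * (m * m) + m ∎
    where open ≡-Reasoning

  signature∈labels : ∀ {s u} (L : LeafBeyond s u) → inj₁ (signature L) ∈ labels
  signature∈labels L = ∈-++⁺ˡ (∈-map⁺ inj₁ (∈-offDiagonal (∈-allFin _)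
    (λ same → proper C (leaf L) (parent L) (Pendant.adjacent (pendant L)) (sym same))))

  label₂∈labels : ∀ {u} (v~u : Adj G v u) k → label₂ v~u k ∈ labels
  label₂∈labels {u} v~u (poor a _ a-seen) =
    ∈-++⁺ʳ (map inj₁ _) (∈-map⁺ inj₂ (∈-offDiagonal (∈-otherColours u≢c) (a≢u a-seen)))
    where
    u≢c : cl u ≢ c
    u≢c u≡c = proper C v u v~u (sym u≡c)
    a≢u : a ≡ c ⊎ NbrHasColor C u a → a ≢ cl u
    a≢u (inj₁ a≡c)             a≡u = u≢c (trans (sym a≡u) a≡c)
    a≢u (inj₂ (w , u~w , w-a)) a≡u = proper C u w u~w (sym (trans w-a a≡u))
  label₂∈labels v~u (rich _ _ _ u~w₂ _ w₂≢c _) = signature∈labels (leafThrough v~u u~w₂ w₂≢c)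

  label∈labels : ∀ x gx → label x gx ∈ labels
  label∈labels (inj₁ u) v~u = signature∈labels (firstLeaf v~u (kind u))
  label∈labels (inj₂ u) v~u = label₂∈labels v~u (kind u)

  copies : List (V ⊎ V)
  copies = map inj₁ (allFin n) ++ map inj₂ (allFin n)

  copies-unique : Unique copies
  copies-unique = Unique.++⁺ (Unique.map⁺ inj₁-injective (Unique.allFin⁺ n))
                             (Unique.map⁺ inj₂-injective (Unique.allFin⁺ n)) disjoint
    where
    disjoint : ∀ {z} → ¬ (z ∈ map inj₁ (allFin n) × z ∈ map inj₂ (allFin n))
    disjoint (z∈₁ , z∈₂) with ∈-map⁻ inj₁ z∈₁ | ∈-map⁻ inj₂ z∈₂
    ... | _ , _ , refl | _ , _ , ()

  count-copies : count isNeighbour copies ≡ 2 * degree G v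
  count-copies = begin
    count isNeighbour copies
      ≡⟨ count-++ isNeighbour (map inj₁ (allFin n)) (map inj₂ (allFin n)) ⟩
    count isNeighbour (map inj₁ (allFin n)) + count isNeighbour (map inj₂ (allFin n))
      ≡⟨ cong₂ _+_ (count-map isNeighbour inj₁ (allFin n)) (count-map isNeighbour inj₂ (allFin n)) ⟩
    degree G v + degree G v
      ≡⟨ cong (degree G v +_) (+-identityʳ (degree G v)) ⟨
    2 * degree G v ∎
    where open ≡-Reasoning

  open CountByInjection isNeighbour label label-injective

  degree-bound : 2 * degree G v ≤ 2 * (m * m) + m
  degree-bound = subst₂ _≤_ count-copies length-labels (count-≤ copies labels copies-unique label∈labels)

-- Degree bound for every vertex of an acyclic graph with an NL-colouring by k
-- colours (with no colours there are no vertices).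
nl-degree-bound : ∀ {n} (G : Graph n) k → Acyclic G → (C : Coloring G k) → IsNeighborLocating C →
                  ∀ v → 2 * degree G v ≤ 2 * ((k ∸ 1) * (k ∸ 1)) + (k ∸ 1)
nl-degree-bound G zero    _        C _  v with col C v
... | ()
nl-degree-bound G (suc m) acyclic C nl v = DegreeBound.degree-bound G acyclic C nl v

maxDegree-bound : ∀ {n} (G : Graph n) {B} → (∀ v → 2 * degree G v ≤ B) → 2 * maxDegree G ≤ B
maxDegree-bound G {B} bounded =
  foldr-preservesᵇ {P = λ d → 2 * d ≤ B} {f = _⊔_}
    (λ {x} {y} p q → subst (_≤ B) (sym (*-distribˡ-⊔ 2 x y)) (⊔-lub p q)) z≤n
    (All-map⁺ (tabulate⁺ bounded))

proposition28 : ∀ {n} (T : Graph n) (k : ℕ) → IsTree T → χNL≡ T k →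
    2 * maxDegree T ≤ 2 * ((k ∸ 1) * (k ∸ 1)) + (k ∸ 1)
proposition28 T k (_ , _ , acyclic) ((C , nl) , _) =
  maxDegree-bound T (nl-degree-bound T k acyclic C nl)
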